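{- For every category $\mathcal{C}$, there is an equivalence of types between the type of representable maps of presheaves on $\mathcal{C}$ and the type of weak universes relative to the Yoneda embedding $y:\mathcal{C}\to\mathrm{PSh}(\mathcal{C})$.
   Context: Function extensionality is assumed. $\mathrm{PSh}(\mathcal{C})$ is the category of presheaves $\mathcal{C}^{op}\to\mathbf{Set}$, $y$ the Yoneda embedding, $\bar x:y(\Gamma)\to P$ the Yoneda transpose of $x\in P(\Gamma)$, $f^*x=P(f)(x)$, composition diagrammatic. A representable map of presheaves on $\mathcal{C}$ is a triple of presheaves $\mathrm{Ty},\mathrm{Tm}$ and a natural transformation $p:\mathrm{Tm}\to\mathrm{Ty}$ such that for each object $\Gamma$ and $A\in\mathrm{Ty}(\Gamma)$ there merely exist (propositional truncation) an object $\Gamma.A$, a morphism $\pi_A:\Gamma.A\to\Gamma$ and $\mathrm{te}_A\in\mathrm{Tm}(\Gamma.A)$ with $p(\mathrm{te}_A)=\pi_A^*A$ such that the square $\overline{\mathrm{te}_A}$, $y(\pi_A)$, $p$, $\bar A$ is a pullback of presheaves. For a functor $J:\mathcal{C}\to\mathcal{D}$, a $J$-pullback of $p:\tilde U\to U$ along $f:J(X)\to U$ is an object $X'$ of $\mathcal{C}$ with $p':X'\to X$ and $Q:J(X')\to\tilde U$ such that $Q;p=J(p');f$ is a pullback square in $\mathcal{D}$; a weak universe relative to $J$ is a morphism $p:\tilde U\to U$ of $\mathcal{D}$ such that for all objects $X$ of $\mathcal{C}$ and $f:J(X)\to U$ there merely exists a $J$-pullback of $p$ along $f$. -}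

module Defs where

open import Level using (Level; _⊔_) renaming (suc to lsuc)
open import Relation.Binary.PropositionalEquality using (_≡_; trans; cong)
open import Data.Product using (Σ; _×_)

isProp : ∀ {a} → Set a → Set a
isProp A = (x y : A) → x ≡ y

isSet : ∀ {a} → Set a → Set a
isSet A = (x y : A) → isProp (x ≡ y)

isContr : ∀ {a} → Set a → Set a
isContr A = Σ A λ c → (x : A) → c ≡ x

∥_∥ : ∀ {a} → Set a → Set (lsuc a)
∥_∥ {a} A = (P : Set a) → isProp P → (A → P) → P

-- Categories (composition written diagrammatically: f ⨾ g means first f then g)
record Category (o h : Level) : Set (lsuc (o ⊔ h)) where
  infixr 9 _⨾_
  field
    Ob        : Set o
    Hom       : Ob → Ob → Set h
    id        : ∀ {X} → Hom X X
    _⨾_       : ∀ {X Y Z} → Hom X Y → Hom Y Z → Hom X Z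
    idˡ       : ∀ {X Y} (f : Hom X Y) → (id ⨾ f) ≡ f
    idʳ       : ∀ {X Y} (f : Hom X Y) → (f ⨾ id) ≡ f
    assoc     : ∀ {W X Y Z} (f : Hom W X) (g : Hom X Y) (k : Hom Y Z) →
                ((f ⨾ g) ⨾ k) ≡ (f ⨾ (g ⨾ k))
    Hom-isSet : ∀ {X Y} → isSet (Hom X Y)

module _ {o h : Level} (𝒞 : Category o h) where
  open Category 𝒞

  -- Presheaves 𝒞^op → Set (set-valued functors); F₁ f x is f^* x
  record Presheaf : Set (o ⊔ lsuc h) where
    field
      F₀       : Ob → Set h
      F₀-isSet : ∀ Γ → isSet (F₀ Γ)
      F₁       : ∀ {Γ Δ} → Hom Γ Δ → F₀ Δ → F₀ Γ
      F-id     : ∀ {Γ} (x : F₀ Γ) → F₁ id x ≡ x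
      F-comp   : ∀ {Γ Δ Θ} (f : Hom Γ Δ) (g : Hom Δ Θ) (x : F₀ Θ) →
                 F₁ (f ⨾ g) x ≡ F₁ f (F₁ g x)
  open Presheaf public

  record _⇒_ (P Q : Presheaf) : Set (o ⊔ h) where
    field
      η   : ∀ Γ → F₀ P Γ → F₀ Q Γ
      nat : ∀ {Γ Δ} (f : Hom Γ Δ) (x : F₀ P Δ) → η Γ (F₁ P f x) ≡ F₁ Q f (η Δ x)
  open _⇒_ public

  -- diagrammatic composition in PSh(𝒞)
  _⊙_ : ∀ {P Q R} → P ⇒ Q → Q ⇒ R → P ⇒ R
  _⊙_ {P} {Q} {R} α β = record
    { η   = λ Γ x → η β Γ (η α Γ x)
    ; nat = λ {Γ} {Δ} f x →
        trans
          (cong (η β Γ) (nat α f x))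
          (nat β f (η α Δ x)) }

  y : Ob → Presheaf
  y X = record
    { F₀ = λ Γ → Hom Γ X
    ; F₀-isSet = λ Γ → Hom-isSet
    ; F₁ = λ f g → f ⨾ g
    ; F-id = idˡ
    ; F-comp = assoc }

  y₁ : ∀ {X Y} → Hom X Y → y X ⇒ y Y
  y₁ f = record
    { η = λ Γ g → g ⨾ f
    ; nat = λ k g → assoc k g f }

  bar : (P : Presheaf) {Γ : Ob} → F₀ P Γ → y Γ ⇒ P
  bar P x = record
    { η = λ Δ f → F₁ P f x
    ; nat = λ g f → F-comp P g f x }

  IsPullback : ∀ {S A B C} → (p₁ : S ⇒ A) (p₂ : S ⇒ B) (f : A ⇒ C) (g : B ⇒ C) →
               Set (o ⊔ lsuc h)
  IsPullback {S} {A} {B} {C} p₁ p₂ f g =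
    ((p₁ ⊙ f) ≡ (p₂ ⊙ g)) ×
    ((W : Presheaf) (q₁ : W ⇒ A) (q₂ : W ⇒ B) → (q₁ ⊙ f) ≡ (q₂ ⊙ g) →
       isContr (Σ (W ⇒ S) λ u → ((u ⊙ p₁) ≡ q₁) × ((u ⊙ p₂) ≡ q₂)))

  IsRepresentable : ∀ {Ty Tm : Presheaf} → Tm ⇒ Ty → Set (lsuc (o ⊔ lsuc h))
  IsRepresentable {Ty} {Tm} p =
    (Γ : Ob) (A : F₀ Ty Γ) →
    ∥ Σ Ob (λ ΓA → Σ (Hom ΓA Γ) λ πA → Σ (F₀ Tm ΓA) λ teA →
        (η p ΓA teA ≡ F₁ Ty πA A) × IsPullback (bar Tm teA) (y₁ πA) p (bar Ty A)) ∥

  RepresentableMap : Set (lsuc (o ⊔ lsuc h))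
  RepresentableMap = Σ Presheaf λ Ty → Σ Presheaf λ Tm → Σ (Tm ⇒ Ty) λ p → IsRepresentable p

  YPullback : ∀ {Ũ U : Presheaf} → Ũ ⇒ U → (X : Ob) → y X ⇒ U → Set (o ⊔ lsuc h)
  YPullback {Ũ} {U} p X f =
    Σ Ob λ X' → Σ (Hom X' X) λ p' → Σ (y X' ⇒ Ũ) λ Q → IsPullback Q (y₁ p') p f

  IsWeakUniverse : ∀ {Ũ U : Presheaf} → Ũ ⇒ U → Set (lsuc (o ⊔ lsuc h))
  IsWeakUniverse {Ũ} {U} p = (X : Ob) (f : y X ⇒ U) → ∥ YPullback p X f ∥

  WeakUniverse : Set (lsuc (o ⊔ lsuc h))
  WeakUniverse = Σ Presheaf λ Ũ → Σ Presheaf λ U → Σ (Ũ ⇒ U) λ p → IsWeakUniverse p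

-- A representable map and a weak universe relative to y are the same data (Ty, Tm, p) with
-- two propositional conditions, so it suffices that these conditions imply each other. By
-- Yoneda, a map f : y(X) → Ty is the transpose of A = f_X(id), and a map Q : y(X') → Tm is the
-- transpose of te = Q_X'(id); so a y-pullback of p along Ā is literally a context extension
-- (X', p', te) for A.
module Submission where

open import Defs
open import Level using (Level; _⊔_) renaming (suc to lsuc)
open import Function.Bundles using (_↔_; mk↔ₛ′)
open import Axiom.Extensionality.Propositional using (Extensionality; implicit-extensionality)
open import Relation.Binary.PropositionalEquality using (_≡_; refl; sym; trans; cong; subst)
open import Data.Product using (Σ; _×_; _,_; proj₁)

∥∥-map : ∀ {a} {A B : Set a} → (A → B) → ∥ A ∥ → ∥ B ∥
∥∥-map f t P P-isProp k = t P P-isProp (λ a → k (f a))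

module _ (funext : ∀ {a b} → Extensionality a b) where

  Π-isProp : ∀ {a b} {A : Set a} {B : A → Set b} →
             (∀ x → isProp (B x)) → isProp ((x : A) → B x)
  Π-isProp B-isProp f g = funext λ x → B-isProp x (f x) (g x)

  ∥∥-isProp : ∀ {a} {A : Set a} → isProp ∥ A ∥
  ∥∥-isProp = Π-isProp λ P → Π-isProp λ P-isProp → Π-isProp λ _ → P-isProp

  module _ {o h : Level} (𝒞 : Category o h) where
    open Category 𝒞

    private
      _⟶_ : Presheaf 𝒞 → Presheaf 𝒞 → Set (o ⊔ h)
      P ⟶ Q = _⇒_ 𝒞 P Q

    ⇒-ext : {P Q : Presheaf 𝒞} {α β : P ⟶ Q} → (∀ Γ x → η α Γ x ≡ η β Γ x) → α ≡ β
    ⇒-ext {P} {Q} {record { η = η₁ ; nat = nat₁ }} {record { η = η₂ ; nat = nat₂ }} e =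
      ⇒-≡ (funext λ Γ → funext (e Γ)) nat₁ nat₂
      where
      Natural : (∀ Γ → F₀ P Γ → F₀ Q Γ) → Set (o ⊔ h)
      Natural η′ = ∀ {Γ Δ} (f : Hom Γ Δ) (x : F₀ P Δ) → η′ Γ (F₁ P f x) ≡ F₁ Q f (η′ Δ x)

      Natural-isProp : ∀ η′ → isProp (Natural η′)
      Natural-isProp η′ n₁ n₂ =
        implicit-extensionality funext λ {Γ} → implicit-extensionality funext λ {Δ} →
          funext λ f → funext λ x → F₀-isSet Q Γ _ _ (n₁ f x) (n₂ f x)

      ⇒-≡ : {η₁ η₂ : ∀ Γ → F₀ P Γ → F₀ Q Γ} → η₁ ≡ η₂ → (n₁ : Natural η₁) (n₂ : Natural η₂) →
            _≡_ {A = P ⟶ Q} (record { η = η₁ ; nat = n₁ }) (record { η = η₂ ; nat = n₂ })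
      ⇒-≡ {η₁} refl n₁ n₂ =
        cong (λ (n : Natural η₁) → record { η = η₁ ; nat = n }) (Natural-isProp η₁ n₁ n₂)

    ContextExtension : {Ty Tm : Presheaf 𝒞} (p : Tm ⟶ Ty) (Γ : Ob) → F₀ Ty Γ → Set (o ⊔ lsuc h)
    ContextExtension {Ty} {Tm} p Γ A =
      Σ Ob λ ΓA → Σ (Hom ΓA Γ) λ πA → Σ (F₀ Tm ΓA) λ teA →
        (η p ΓA teA ≡ F₁ Ty πA A) × IsPullback 𝒞 (bar 𝒞 Tm teA) (y₁ 𝒞 πA) p (bar 𝒞 Ty A)

    bar-η-id : (P : Presheaf 𝒞) {X : Ob} (f : y 𝒞 X ⟶ P) → bar 𝒞 P (η f X id) ≡ f
    bar-η-id P {X} f = ⇒-ext λ Δ g → trans (sym (nat f g id)) (cong (η f Δ) (idʳ g))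

    IsRepresentable⇒IsWeakUniverse : {Ty Tm : Presheaf 𝒞} (p : Tm ⟶ Ty) →
                                     IsRepresentable 𝒞 p → IsWeakUniverse 𝒞 p
    IsRepresentable⇒IsWeakUniverse {Ty} {Tm} p rep X f = ∥∥-map yPullback (rep X (η f X id))
      where
      yPullback : ContextExtension p X (η f X id) → YPullback 𝒞 p X f
      yPullback (X′ , p′ , te , _ , pb) =
        X′ , p′ , bar 𝒞 Tm te ,
        subst (IsPullback 𝒞 (bar 𝒞 Tm te) (y₁ 𝒞 p′) p) (bar-η-id Ty f) pb

    IsWeakUniverse⇒IsRepresentable : {Ty Tm : Presheaf 𝒞} (p : Tm ⟶ Ty) →
                                     IsWeakUniverse 𝒞 p → IsRepresentable 𝒞 p
    IsWeakUniverse⇒IsRepresentable {Ty} {Tm} p weak Γ A = ∥∥-map extension (weak Γ (bar 𝒞 Ty A))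
      where
      extension : YPullback 𝒞 p Γ (bar 𝒞 Ty A) → ContextExtension p Γ A
      extension (X′ , p′ , Q , pb) = X′ , p′ , η Q X′ id , te-typed , pb′
        where
        te-typed : η p X′ (η Q X′ id) ≡ F₁ Ty p′ A
        te-typed = trans (cong (λ α → η α X′ id) (proj₁ pb)) (cong (λ k → F₁ Ty k A) (idˡ p′))

        pb′ : IsPullback 𝒞 (bar 𝒞 Tm (η Q X′ id)) (y₁ 𝒞 p′) p (bar 𝒞 Ty A)
        pb′ = subst (λ k → IsPullback 𝒞 k (y₁ 𝒞 p′) p (bar 𝒞 Ty A)) (sym (bar-η-id Tm Q)) pb

    IsRepresentable-isProp : {Ty Tm : Presheaf 𝒞} (p : Tm ⟶ Ty) → isProp (IsRepresentable 𝒞 p)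
    IsRepresentable-isProp p = Π-isProp λ _ → Π-isProp λ _ → ∥∥-isProp

    IsWeakUniverse-isProp : {Ũ U : Presheaf 𝒞} (p : Ũ ⟶ U) → isProp (IsWeakUniverse 𝒞 p)
    IsWeakUniverse-isProp p = Π-isProp λ _ → Π-isProp λ _ → ∥∥-isProp

mainTheorem14 : (funext : ∀ {a b} → Extensionality a b) →
    ∀ {o h : Level} (𝒞 : Category o h) →
    RepresentableMap 𝒞 ↔ WeakUniverse 𝒞
mainTheorem14 funext 𝒞 = mk↔ₛ′
  (λ { (Ty , Tm , p , rep)  → Tm , Ty , p , IsRepresentable⇒IsWeakUniverse funext 𝒞 p rep })
  (λ { (Tm , Ty , p , weak) → Ty , Tm , p , IsWeakUniverse⇒IsRepresentable funext 𝒞 p weak })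
  (λ { (Tm , Ty , p , weak) → cong (λ w → Tm , Ty , p , w)
         (IsWeakUniverse-isProp funext 𝒞 p _ weak) })
  (λ { (Ty , Tm , p , rep)  → cong (λ r → Ty , Tm , p , r)
         (IsRepresentable-isProp funext 𝒞 p _ rep) })
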